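{- For every integer $k \geq 4$, let $G$ be the tree constructed as follows. Take a vertex $v_0$ adjacent to three vertices $v_1, v_2, v_3$ (and to no other vertices). Attach to $v_1$ three pendant paths with two vertices each, to $v_2$ exactly $k$ pendant paths with two vertices each, and to $v_3$ exactly $k+2$ pendant paths with two vertices each; here attaching a pendant path $a b$ (a copy of $K_2$) to $v_i$ means adding new vertices $a, b$ and edges $v_i a$ and $a b$. Then the independence polynomial of $G$ is not log-concave.
   Context: An independent set in a graph is a set of pairwise non-adjacent vertices; $\alpha(G)$ denotes the maximum size of an independent set. The independence polynomial of $G$ is $I(G;x)=\sum_{k=0}^{\alpha(G)} s_k x^k$, where $s_k$ is the number of independent sets of size $k$ in $G$. A polynomial $\sum_{k=0}^{n} a_k x^k$ is called log-concave if its coefficient sequence satisfies $a_k^2 \geq a_{k-1}a_{k+1}$ for all $k\in\{1,\dots,n-1\}$. -}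

module Defs where

open import Data.Bool using (Bool; true; false; _∧_; _∨_; not)
open import Data.Nat using (ℕ; zero; suc; _+_; _*_; _≤_; _<_; _⊔_; _≡ᵇ_)
open import Data.Product using (_×_; _,_)
open import Data.List using (List; []; _∷_; _++_; map; filterᵇ; length; foldr; upTo; allFin)
open import Data.Bool.ListAction using (all; any)
open import Data.Vec using (Vec; []; _∷_; lookup)
open import Data.Fin using (Fin; toℕ)
open import Data.Fin.Subset using (Subset; ∣_∣; inside; outside)

-- A finite simple graph on vertex set Fin n (vertices identified with 0..n-1),
-- given by an undirected edge list (each pair {u,v} stands for the edge uv).
record Graph : Set where
  field
    n     : ℕ
    edges : List (ℕ × ℕ)
open Graph public

adj : (G : Graph) → Fin (n G) → Fin (n G) → Bool
adj G u v = any (λ { (a , b) → ((a ≡ᵇ toℕ u) ∧ (b ≡ᵇ toℕ v)) ∨ ((a ≡ᵇ toℕ v) ∧ (b ≡ᵇ toℕ u)) }) (edges G)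

mem : ∀ {m} → Fin m → Subset m → Bool
mem i S = lookup S i

isIndependent : (G : Graph) → Subset (n G) → Bool
isIndependent G S =
  all (λ u → all (λ v → not (mem u S ∧ mem v S ∧ adj G u v)) (allFin (n G))) (allFin (n G))

allSubsets : (m : ℕ) → List (Subset m)
allSubsets zero = [] ∷ []
allSubsets (suc m) = map (inside ∷_) (allSubsets m) ++ map (outside ∷_) (allSubsets m)

independentSets : (G : Graph) → List (Subset (n G))
independentSets G = filterᵇ (isIndependent G) (allSubsets (n G))

indepCount : Graph → ℕ → ℕ
indepCount G j = length (filterᵇ (λ S → ∣ S ∣ ≡ᵇ j) (independentSets G))

α : Graph → ℕ
α G = foldr _⊔_ 0 (map ∣_∣ (independentSets G))

indepPoly : Graph → List ℕ
indepPoly G = map (indepCount G) (upTo (suc (α G)))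

-- k-th entry of a coefficient list (0 outside the list; only used in range)
coeff : List ℕ → ℕ → ℕ
coeff [] _ = 0
coeff (a ∷ as) zero = a
coeff (a ∷ as) (suc k) = coeff as k

LogConcave : List ℕ → Set
LogConcave as = ∀ k → suc k < length as → suc (suc k) < length as →
  coeff as k * coeff as (suc (suc k)) ≤ coeff as (suc k) * coeff as (suc k)

pendants : ℕ → ℕ → ℕ → List (ℕ × ℕ)
pendants v zero s = []
pendants v (suc c) s = (v , s) ∷ (s , suc s) ∷ pendants v c (suc (suc s))

-- the tree of the theorem: v0 = 0 adjacent to v1 = 1, v2 = 2, v3 = 3;
-- 3 pendant K2's at v1 (labels 4..9), k at v2 (labels 10..9+2k),
-- k+2 at v3 (labels 10+2k..13+4k).  Total 14 + 4k vertices.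
treeG : ℕ → Graph
treeG k = record
  { n = 14 + 4 * k
  ; edges = (0 , 1) ∷ (0 , 2) ∷ (0 , 3) ∷
            (pendants 1 3 4 ++ pendants 2 k 10 ++ pendants 3 (k + 2) (10 + 2 * k))
  }

module Submission where

-- An independent set is determined by its trace on v₀, …, v₃ and on the 2k + 5 pendant paths, and a
-- pendant path contributes a factor 1 + x to I(G; x) if its attachment vertex is in the set and 1 + 2x
-- otherwise. So I(G; x) = x (1 + 2x)^(2k+5) + Σ_{S ⊆ {v₁,v₂,v₃}} x^|S| (1 + x)^(paths at S) (1 + 2x)^(other paths).
-- Its coefficients at N = 2k + 8, N - 1 and N - 2 are 1, 5·2^k + 2k + 13 and at least 36·4^k + (4k + 52)·2^k,
-- and for k ≥ 4 the last one exceeds the square of the middle one.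

open import Defs
open import Data.Bool using (Bool; true; false; _∧_; not; T)
open import Data.Bool.Properties using (∧-assoc; ∧-zeroʳ; T-∧; T-∨; T-≡)
open import Data.Bool.ListAction using (all; any)
open import Data.Empty using (⊥; ⊥-elim)
open import Data.Fin using (Fin; toℕ) renaming (zero to fzero; suc to fsuc)
open import Data.Fin.Subset using (Subset; ∣_∣; inside; outside)
open import Data.List using (List; []; _∷_; _++_; map; filterᵇ; length; foldr; upTo; applyUpTo; allFin; drop; replicate)
open import Data.List.Properties using (drop-drop; length-++; length-replicate; length-map; length-upTo)
open import Data.List.Membership.Propositional using (_∈_; find; lose)
open import Data.List.Membership.Propositional.Properties using (∈-allFin)
open import Data.List.Relation.Unary.All using () renaming (lookup to All-lookup; tabulate to All-tabulate)
open import Data.List.Relation.Unary.All.Properties using (all⁺; all⁻)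
open import Data.List.Relation.Unary.Any using (here; there)
open import Data.List.Relation.Unary.Any.Properties using (any⁺; any⁻)
open import Data.Nat using (ℕ; zero; suc; _+_; _*_; _^_; _≤_; _<_; _⊔_; _≡ᵇ_; z≤n; s≤s)
open import Data.Nat.Properties
open import Data.Nat.Tactic.RingSolver using (solve-∀)
open import Data.Product using (_×_; _,_; proj₁; proj₂; ∃)
open import Data.Sum using (_⊎_; inj₁; [_,_]) renaming (map to ⊎-map)
open import Data.Vec using ([]; _∷_; lookup; toList)
open import Function using (_∘_; Equivalence)
open import Relation.Binary.PropositionalEquality using (_≡_; refl; sym; trans; cong; cong₂; subst; subst₂; module ≡-Reasoning)
open import Relation.Nullary using (¬_)

countᵇ : {A : Set} → (A → Bool) → List A → ℕ
countᵇ p xs = length (filterᵇ p xs)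

module _ {A : Set} where

  countᵇ-++ : (p : A → Bool) (xs ys : List A) → countᵇ p (xs ++ ys) ≡ countᵇ p xs + countᵇ p ys
  countᵇ-++ p [] ys = refl
  countᵇ-++ p (x ∷ xs) ys with p x
  ... | true  = cong suc (countᵇ-++ p xs ys)
  ... | false = countᵇ-++ p xs ys

  countᵇ-map : {B : Set} (p : B → Bool) (f : A → B) (xs : List A) → countᵇ p (map f xs) ≡ countᵇ (p ∘ f) xs
  countᵇ-map p f [] = refl
  countᵇ-map p f (x ∷ xs) with p (f x)
  ... | true  = cong suc (countᵇ-map p f xs)
  ... | false = countᵇ-map p f xs

  countᵇ-cong : {p q : A → Bool} → (∀ x → p x ≡ q x) → (xs : List A) → countᵇ p xs ≡ countᵇ q xs
  countᵇ-cong p≗q [] = refl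
  countᵇ-cong {p} {q} p≗q (x ∷ xs) with p x | q x | p≗q x
  ... | true  | .true  | refl = cong suc (countᵇ-cong p≗q xs)
  ... | false | .false | refl = countᵇ-cong p≗q xs

  countᵇ-none : {p : A → Bool} → (∀ x → p x ≡ false) → (xs : List A) → countᵇ p xs ≡ 0
  countᵇ-none p≗false [] = refl
  countᵇ-none p≗false (x ∷ xs) rewrite p≗false x = countᵇ-none p≗false xs

  countᵇ-filterᵇ : (p q : A → Bool) (xs : List A) → countᵇ q (filterᵇ p xs) ≡ countᵇ (λ x → p x ∧ q x) xs
  countᵇ-filterᵇ p q [] = refl
  countᵇ-filterᵇ p q (x ∷ xs) with p x
  ... | false = countᵇ-filterᵇ p q xs
  ... | true with q x
  ...   | true  = cong suc (countᵇ-filterᵇ p q xs)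
  ...   | false = countᵇ-filterᵇ p q xs

  countᵇ-witness : (p : A → Bool) (xs : List A) → 0 < countᵇ p xs → ∃ λ x → x ∈ xs × T (p x)
  countᵇ-witness p (x ∷ xs) pos with p x in px
  ... | true  = x , here refl , Equivalence.from T-≡ px
  ... | false with countᵇ-witness p xs pos
  ...   | y , y∈xs , py = y , there y∈xs , py

countStrings : (List Bool → Bool) → ℕ → ℕ
countStrings Q m = countᵇ (Q ∘ toList) (allSubsets m)

Σ𝔹 : (Bool → ℕ) → ℕ
Σ𝔹 f = f true + f false

Σ𝔹-cong : ∀ {f g : Bool → ℕ} → (∀ b → f b ≡ g b) → Σ𝔹 f ≡ Σ𝔹 g
Σ𝔹-cong f≗g = cong₂ _+_ (f≗g true) (f≗g false)

countStrings-suc : ∀ Q m → countStrings Q (suc m) ≡ Σ𝔹 λ b → countStrings (λ bs → Q (b ∷ bs)) m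
countStrings-suc Q m =
  trans (countᵇ-++ (Q ∘ toList) (map (inside ∷_) (allSubsets m)) _)
        (cong₂ _+_ (countᵇ-map (Q ∘ toList) (inside ∷_) (allSubsets m)) (countᵇ-map (Q ∘ toList) (outside ∷_) (allSubsets m)))

countStrings-pair : ∀ Q m → countStrings Q (2 + m) ≡ Σ𝔹 λ a → Σ𝔹 λ b → countStrings (λ bs → Q (a ∷ b ∷ bs)) m
countStrings-pair Q m = trans (countStrings-suc Q (suc m)) (Σ𝔹-cong λ a → countStrings-suc (λ bs → Q (a ∷ bs)) m)

countStrings-cong : ∀ {Q R} → (∀ L → Q L ≡ R L) → ∀ m → countStrings Q m ≡ countStrings R m
countStrings-cong Q≗R m = countᵇ-cong (Q≗R ∘ toList) (allSubsets m)

countStrings-none : ∀ {Q} → (∀ L → Q L ≡ false) → ∀ m → countStrings Q m ≡ 0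
countStrings-none Q≗false m = countᵇ-none (Q≗false ∘ toList) (allSubsets m)

countStrings-false : ∀ m → countStrings (λ _ → false) m ≡ 0
countStrings-false = countStrings-none (λ _ → refl)

countStrings-∧false : ∀ (Q : List Bool → Bool) m → countStrings (λ bs → Q bs ∧ false) m ≡ 0
countStrings-∧false Q = countStrings-none (λ bs → ∧-zeroʳ (Q bs))

weight : List Bool → ℕ
weight [] = 0
weight (true ∷ bs) = suc (weight bs)
weight (false ∷ bs) = weight bs

size≡weight : ∀ {m} (S : Subset m) → ∣ S ∣ ≡ weight (toList S)
size≡weight [] = refl
size≡weight (true ∷ S) = cong suc (size≡weight S)
size≡weight (false ∷ S) = size≡weight S

infixl 9 _!_
_!_ : List Bool → ℕ → Bool
[] ! _ = false
(b ∷ bs) ! zero = b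
(b ∷ bs) ! suc i = bs ! i

notBothIn : List Bool → ℕ × ℕ → Bool
notBothIn L e = not (L ! proj₁ e ∧ L ! proj₂ e)

edgeFree : List Bool → List (ℕ × ℕ) → Bool
edgeFree L = all (notBothIn L)

T-injective : ∀ {x y} → (T x → T y) → (T y → T x) → x ≡ y
T-injective {true} {true} _ _ = refl
T-injective {true} {false} x⇒y _ = ⊥-elim (x⇒y _)
T-injective {false} {true} _ y⇒x = ⊥-elim (y⇒x _)
T-injective {false} {false} _ _ = refl

T-not-∧ : ∀ {x y} → T (not (x ∧ y)) → T x → T y → ⊥
T-not-∧ {true} {true} ()

not-∧-intro : ∀ {x y} → (T x → T y → ⊥) → T (not (x ∧ y))
not-∧-intro {true} {true} both = both _ _
not-∧-intro {true} {false} _ = _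
not-∧-intro {false} _ = _

edgeFree-edge : ∀ L {es a b} → T (edgeFree L es) → (a , b) ∈ es → T (L ! a) → T (L ! b) → ⊥
edgeFree-edge L {es} free ab∈es = T-not-∧ (All-lookup (all⁺ (notBothIn L) es free) ab∈es)

edgeFree-intro : ∀ L {es} → (∀ {a b} → (a , b) ∈ es → T (L ! a) → T (L ! b) → ⊥) → T (edgeFree L es)
edgeFree-intro L noEdge = all⁻ (notBothIn L) (All-tabulate λ e∈es → not-∧-intro (noEdge e∈es))

lookup≡! : ∀ {m} (S : Subset m) i → lookup S i ≡ toList S ! toℕ i
lookup≡! (b ∷ S) fzero = refl
lookup≡! (b ∷ S) (fsuc i) = lookup≡! S i

!-true : ∀ {m} (S : Subset m) a → T (toList S ! a) → ∃ λ i → toℕ i ≡ a × T (lookup S i)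
!-true (b ∷ S) zero b-true = fzero , refl , b-true
!-true (b ∷ S) (suc a) Sa with !-true S a Sa
... | i , refl , Si = fsuc i , refl , Si

module _ (G : Graph) where

  adj-intro : ∀ {u v} → (toℕ u , toℕ v) ∈ edges G → T (adj G u v)
  adj-intro {u} {v} uv∈ =
    any⁺ _ (lose {xs = edges G} uv∈ (Equivalence.from (T-∨ {(toℕ u ≡ᵇ toℕ u) ∧ (toℕ v ≡ᵇ toℕ v)})
                                       (inj₁ (Equivalence.from T-∧ (≡⇒≡ᵇ (toℕ u) _ refl , ≡⇒≡ᵇ (toℕ v) _ refl)))))

  edge-matching : ∀ {a b x y} → (a , b) ∈ edges G → T ((a ≡ᵇ x) ∧ (b ≡ᵇ y)) → (x , y) ∈ edges G
  edge-matching {a} {b} ab∈ ab≡xy with Equivalence.to T-∧ ab≡xy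
  ... | a≡x , b≡y = subst (_∈ edges G) (cong₂ _,_ (≡ᵇ⇒≡ a _ a≡x) (≡ᵇ⇒≡ b _ b≡y)) ab∈

  adj-elim : ∀ {u v} → T (adj G u v) → (toℕ u , toℕ v) ∈ edges G ⊎ (toℕ v , toℕ u) ∈ edges G
  adj-elim uv with find (any⁻ _ (edges G) uv)
  ... | _ , ab∈ , match = ⊎-map (edge-matching ab∈) (edge-matching ab∈) (Equivalence.to T-∨ match)

  module _ (S : Subset (n G)) where

    pairOK : Fin (n G) → Fin (n G) → Bool
    pairOK u v = not (mem u S ∧ mem v S ∧ adj G u v)

    independent⇒edgeFree : T (isIndependent G S) → T (edgeFree (toList S) (edges G))
    independent⇒edgeFree indep = edgeFree-intro (toList S) noEdge
      where
      pairFree : ∀ i j → T (pairOK i j)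
      pairFree i j =
        All-lookup (all⁺ (pairOK i) _ (All-lookup (all⁺ (λ u → all (pairOK u) (allFin (n G))) _ indep) (∈-allFin i))) (∈-allFin j)
      noEdge : ∀ {a b} → (a , b) ∈ edges G → T (toList S ! a) → T (toList S ! b) → ⊥
      noEdge {a} {b} ab∈ Sa Sb with !-true S a Sa | !-true S b Sb
      ... | i , refl , Si | j , refl , Sj = T-not-∧ (pairFree i j) Si (Equivalence.from T-∧ (Sj , adj-intro ab∈))

    edgeFree⇒independent : T (edgeFree (toList S) (edges G)) → T (isIndependent G S)
    edgeFree⇒independent free =
      all⁻ (λ i → all (pairOK i) (allFin (n G))) {xs = allFin (n G)}
           (All-tabulate λ {i} _ → all⁻ (pairOK i) {xs = allFin (n G)} (All-tabulate λ {j} _ → pairFree i j))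
      where
      inS : ∀ {i} → T (mem i S) → T (toList S ! toℕ i)
      inS {i} = subst T (lookup≡! S i)
      pairFree : ∀ i j → T (pairOK i j)
      pairFree i j = not-∧-intro λ Si Sj∧ij → let Sj , ij = Equivalence.to T-∧ Sj∧ij in
        [ (λ ij∈ → edgeFree-edge (toList S) free ij∈ (inS Si) (inS Sj))
        , (λ ji∈ → edgeFree-edge (toList S) free ji∈ (inS Sj) (inS Si)) ] (adj-elim ij)

isIndependent≡edgeFree : ∀ G S → isIndependent G S ≡ edgeFree (toList S) (edges G)
isIndependent≡edgeFree G S = T-injective (independent⇒edgeFree G S) (edgeFree⇒independent G S)

indepCount≡countStrings : ∀ G j → indepCount G j ≡ countStrings (λ L → edgeFree L (edges G) ∧ (weight L ≡ᵇ j)) (n G)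
indepCount≡countStrings G j =
  trans (countᵇ-filterᵇ (isIndependent G) _ (allSubsets (n G)))
        (countᵇ-cong (λ S → cong₂ _∧_ (isIndependent≡edgeFree G S) (cong (_≡ᵇ j) (size≡weight S))) (allSubsets (n G)))

!-drop : ∀ s i L → drop s L ! i ≡ L ! (i + s)
!-drop zero i L = cong (L !_) (sym (+-identityʳ i))
!-drop (suc s) i [] = refl
!-drop (suc s) i (b ∷ L) rewrite +-suc i s = !-drop s i L

-- bs lists the vertices of consecutive pendant paths, two per path, the neighbour of the attachment
-- vertex first; cs says, path by path, whether that attachment vertex is in the set.
pendantsFree : List Bool → List Bool → Bool
pendantsFree [] bs = true
pendantsFree (c ∷ cs) bs = not (c ∧ bs ! 0) ∧ (not (bs ! 0 ∧ bs ! 1) ∧ pendantsFree cs (drop 2 bs))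

edgeFree-pendants : ∀ L v c s → edgeFree L (pendants v c s) ≡ pendantsFree (replicate c (L ! v)) (drop s L)
edgeFree-pendants L v zero s = refl
edgeFree-pendants L v (suc c) s
  rewrite !-drop s 0 L | !-drop s 1 L | drop-drop s 2 L | +-comm s 2 | edgeFree-pendants L v c (2 + s) = refl

edgeFree-++ : ∀ L es fs → edgeFree L (es ++ fs) ≡ edgeFree L es ∧ edgeFree L fs
edgeFree-++ L [] fs = refl
edgeFree-++ L (e ∷ es) fs rewrite edgeFree-++ L es fs = sym (∧-assoc (notBothIn L e) (edgeFree L es) _)

pendantsFree-++ : ∀ cs ds bs → pendantsFree (cs ++ ds) bs ≡ pendantsFree cs bs ∧ pendantsFree ds (drop (2 * length cs) bs)
pendantsFree-++ [] ds bs = refl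
pendantsFree-++ (c ∷ cs) ds bs
  rewrite pendantsFree-++ cs ds (drop 2 bs) | drop-drop 2 (2 * length cs) bs | *-suc 2 (length cs)
  = trans (cong (not (c ∧ bs ! 0) ∧_) (sym (∧-assoc (not (bs ! 0 ∧ bs ! 1)) (pendantsFree cs (drop 2 bs)) _)))
          (sym (∧-assoc (not (c ∧ bs ! 0)) _ _))

choices : Bool → ℕ
choices true = 1
choices false = 2

-- The coefficient of x^j in Π_{c ∈ cs} (1 + choices c · x).
pendantCount : List Bool → ℕ → ℕ
pendantCount [] zero = 1
pendantCount [] (suc j) = 0
pendantCount (c ∷ cs) zero = pendantCount cs zero
pendantCount (c ∷ cs) (suc j) = pendantCount cs (suc j) + choices c * pendantCount cs j

countStrings-pendants-∷ : ∀ c cs j →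
  countStrings (λ bs → pendantsFree (c ∷ cs) bs ∧ (weight bs ≡ᵇ j)) (2 * length (c ∷ cs))
  ≡ Σ𝔹 λ a → Σ𝔹 λ b →
      countStrings (λ bs → pendantsFree (c ∷ cs) (a ∷ b ∷ bs) ∧ (weight (a ∷ b ∷ bs) ≡ᵇ j)) (2 * length cs)
countStrings-pendants-∷ c cs j = trans (cong (countStrings Q) (*-suc 2 (length cs))) (countStrings-pair Q (2 * length cs))
  where
  Q : List Bool → Bool
  Q bs = pendantsFree (c ∷ cs) bs ∧ (weight bs ≡ᵇ j)

countStrings-pendants : ∀ cs j → countStrings (λ bs → pendantsFree cs bs ∧ (weight bs ≡ᵇ j)) (2 * length cs) ≡ pendantCount cs j
countStrings-pendants [] zero = refl
countStrings-pendants [] (suc j) = refl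
countStrings-pendants (c ∷ cs) j = trans (countStrings-pendants-∷ c cs j) (pairs c j)
  where
  m : ℕ
  m = 2 * length cs
  excluded : countStrings (λ _ → false) m ≡ 0
  excluded = countStrings-false m
  tooLarge : countStrings (λ bs → pendantsFree cs bs ∧ false) m ≡ 0
  tooLarge = countStrings-∧false (pendantsFree cs) m
  pairs : ∀ c j →
    Σ𝔹 (λ a → Σ𝔹 λ b → countStrings (λ bs → pendantsFree (c ∷ cs) (a ∷ b ∷ bs) ∧ (weight (a ∷ b ∷ bs) ≡ᵇ j)) m)
    ≡ pendantCount (c ∷ cs) j
  pairs true zero = cong₂ _+_ (cong₂ _+_ excluded excluded) (cong₂ _+_ tooLarge (countStrings-pendants cs 0))
  pairs true (suc j) =
    trans (cong₂ _+_ (cong₂ _+_ excluded excluded) (cong₂ _+_ (countStrings-pendants cs j) (countStrings-pendants cs (suc j))))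
          (rearrange (pendantCount cs j) (pendantCount cs (suc j)))
    where
    rearrange : ∀ a b → a + b ≡ b + 1 * a
    rearrange = solve-∀
  pairs false zero = cong₂ _+_ (cong₂ _+_ excluded tooLarge) (cong₂ _+_ tooLarge (countStrings-pendants cs 0))
  pairs false (suc j) =
    trans (cong₂ _+_ (cong₂ _+_ excluded (countStrings-pendants cs j))
                     (cong₂ _+_ (countStrings-pendants cs j) (countStrings-pendants cs (suc j))))
          (rearrange (pendantCount cs j) (pendantCount cs (suc j)))
    where
    rearrange : ∀ a b → a + (a + b) ≡ b + 2 * a
    rearrange = solve-∀

pendantCount-above : ∀ cs x → pendantCount cs (suc x + length cs) ≡ 0
pendantCount-above [] x = refl
pendantCount-above (c ∷ cs) x
  rewrite +-suc x (length cs) | pendantCount-above cs (suc x) | pendantCount-above cs x = *-zeroʳ (choices c)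

-- pendantCount cs (length cs ∸ d): the coefficients indexed by their distance d from the top degree.
topCount : ℕ → List Bool → ℕ
topCount zero [] = 1
topCount (suc d) [] = 0
topCount zero (c ∷ cs) = choices c * topCount zero cs
topCount (suc d) (c ∷ cs) = topCount d cs + choices c * topCount (suc d) cs

topCount-above : ∀ cs y → topCount (suc y + length cs) cs ≡ 0
topCount-above [] y = refl
topCount-above (c ∷ cs) y
  rewrite +-suc y (length cs) | topCount-above cs y | topCount-above cs (suc y) = *-zeroʳ (choices c)

pendantCount≡topCount : ∀ cs x d → x + d ≡ length cs → pendantCount cs x ≡ topCount d cs
pendantCount≡topCount [] zero zero _ = refl
pendantCount≡topCount (c ∷ cs) zero .(suc (length cs)) refl
  rewrite topCount-above cs 0 | *-zeroʳ (choices c) | +-identityʳ (topCount (length cs) cs) =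
  pendantCount≡topCount cs zero (length cs) refl
pendantCount≡topCount (c ∷ cs) (suc x) zero x+0≡
  rewrite +-identityʳ x | suc-injective x+0≡ | pendantCount-above cs 0 =
  cong (choices c *_) (pendantCount≡topCount cs (length cs) 0 (+-identityʳ (length cs)))
pendantCount≡topCount (c ∷ cs) (suc x) (suc d) x+d≡ =
  cong₂ _+_ (pendantCount≡topCount cs (suc x) d (trans (sym (+-suc x d)) (suc-injective x+d≡)))
            (cong (choices c *_) (pendantCount≡topCount cs x (suc d) (suc-injective x+d≡)))

-- topCount (d ∸ e) if e ≤ d and 0 otherwise, shaped so that it evaluates for concrete d and e.
topCountOffset : ℕ → ℕ → List Bool → ℕ
topCountOffset d zero cs = topCount d cs
topCountOffset zero (suc e) cs = 0
topCountOffset (suc d) (suc e) cs = topCountOffset d e cs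

pendantCount-offset : ∀ cs e x d → x + d ≡ length cs → pendantCount cs (e + x) ≡ topCountOffset d e cs
pendantCount-offset cs zero x d x+d≡ = pendantCount≡topCount cs x d x+d≡
pendantCount-offset cs (suc e) x zero x+0≡ =
  trans (cong (λ y → pendantCount cs (suc e + y)) (trans (sym (+-identityʳ x)) x+0≡)) (pendantCount-above cs e)
pendantCount-offset cs (suc e) x (suc d) x+d≡ =
  trans (cong (pendantCount cs) (sym (+-suc e x))) (pendantCount-offset cs e (suc x) d (trans (sym (+-suc x d)) x+d≡))

topCount₀-replicate-++ : ∀ c b ds → topCount 0 (replicate c b ++ ds) ≡ choices b ^ c * topCount 0 ds
topCount₀-replicate-++ zero b ds = sym (+-identityʳ (topCount 0 ds))
topCount₀-replicate-++ (suc c) b ds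
  rewrite topCount₀-replicate-++ c b ds = sym (*-assoc (choices b) (choices b ^ c) (topCount 0 ds))

topCount₁-replicate-true-++ : ∀ c ds → topCount 1 (replicate c true ++ ds) ≡ topCount 1 ds + c * topCount 0 ds
topCount₁-replicate-true-++ zero ds = sym (+-identityʳ (topCount 1 ds))
topCount₁-replicate-true-++ (suc c) ds
  rewrite topCount₀-replicate-++ c true ds | ^-zeroˡ c | topCount₁-replicate-true-++ c ds = rearrange (topCount 0 ds) (topCount 1 ds) c
  where
  rearrange : ∀ x y c → 1 * x + 1 * (y + c * x) ≡ y + (x + c * x)
  rearrange = solve-∀

topCount₀-replicate : ∀ c b → topCount 0 (replicate c b) ≡ choices b ^ c
topCount₀-replicate zero b = refl
topCount₀-replicate (suc c) b = cong (choices b *_) (topCount₀-replicate c b)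

topCount₁-replicate-true : ∀ c → topCount 1 (replicate c true) ≡ c
topCount₁-replicate-true zero = refl
topCount₁-replicate-true (suc c)
  rewrite topCount₀-replicate c true | ^-zeroˡ c | topCount₁-replicate-true c | +-identityʳ c = refl

Σ𝔹³ : (Bool → Bool → Bool → ℕ) → ℕ
Σ𝔹³ f = Σ𝔹 λ b₁ → Σ𝔹 λ b₂ → Σ𝔹 λ b₃ → f b₁ b₂ b₃

Σ𝔹³-cong : ∀ {f g : Bool → Bool → Bool → ℕ} →
  (∀ b₁ b₂ b₃ → f b₁ b₂ b₃ ≡ g b₁ b₂ b₃) → Σ𝔹³ f ≡ Σ𝔹³ g
Σ𝔹³-cong f≗g = Σ𝔹-cong λ b₁ → Σ𝔹-cong λ b₂ → Σ𝔹-cong λ b₃ → f≗g b₁ b₂ b₃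

absent : Bool → Bool → Bool → ℕ
absent b₁ b₂ b₃ = weight (not b₁ ∷ not b₂ ∷ not b₃ ∷ [])

weight-centre : ∀ b₁ b₂ b₃ x bs → (weight (b₁ ∷ b₂ ∷ b₃ ∷ bs) ≡ᵇ 3 + x) ≡ (weight bs ≡ᵇ absent b₁ b₂ b₃ + x)
weight-centre true true true x bs = refl
weight-centre true true false x bs = refl
weight-centre true false true x bs = refl
weight-centre true false false x bs = refl
weight-centre false true true x bs = refl
weight-centre false true false x bs = refl
weight-centre false false true x bs = refl
weight-centre false false false x bs = refl

module _ (k : ℕ) where

  attach : Bool → Bool → Bool → List Bool
  attach b₁ b₂ b₃ = replicate 3 b₁ ++ replicate k b₂ ++ replicate (k + 2) b₃

  length-attach : ∀ b₁ b₂ b₃ → length (attach b₁ b₂ b₃) ≡ 5 + 2 * k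
  length-attach b₁ b₂ b₃
    rewrite length-++ (replicate k b₂) {replicate (k + 2) b₃} | length-replicate k {b₂} | length-replicate (k + 2) {b₃} =
    rearrange k
    where
    rearrange : ∀ k → 3 + (k + (k + 2)) ≡ 5 + 2 * k
    rearrange = solve-∀

  edgeFree-treeG : ∀ b₀ b₁ b₂ b₃ bs →
    edgeFree (b₀ ∷ b₁ ∷ b₂ ∷ b₃ ∷ bs) (edges (treeG k))
    ≡ not (b₀ ∧ b₁) ∧ (not (b₀ ∧ b₂) ∧ (not (b₀ ∧ b₃) ∧ pendantsFree (attach b₁ b₂ b₃) bs))
  edgeFree-treeG b₀ b₁ b₂ b₃ bs =
    cong (λ rest → not (b₀ ∧ b₁) ∧ (not (b₀ ∧ b₂) ∧ (not (b₀ ∧ b₃) ∧ rest))) pendantEdges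
    where
    open ≡-Reasoning
    L : List Bool
    L = b₀ ∷ b₁ ∷ b₂ ∷ b₃ ∷ bs
    pendantEdges : edgeFree L (pendants 1 3 4 ++ pendants 2 k 10 ++ pendants 3 (k + 2) (10 + 2 * k))
                   ≡ pendantsFree (attach b₁ b₂ b₃) bs
    pendantEdges = begin
      edgeFree L (pendants 1 3 4 ++ pendants 2 k 10 ++ pendants 3 (k + 2) (10 + 2 * k))
        ≡⟨ edgeFree-++ L (pendants 1 3 4) (pendants 2 k 10 ++ pendants 3 (k + 2) (10 + 2 * k)) ⟩
      edgeFree L (pendants 1 3 4) ∧ edgeFree L (pendants 2 k 10 ++ pendants 3 (k + 2) (10 + 2 * k))
        ≡⟨ cong (edgeFree L (pendants 1 3 4) ∧_) (edgeFree-++ L (pendants 2 k 10) (pendants 3 (k + 2) (10 + 2 * k))) ⟩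
      edgeFree L (pendants 1 3 4) ∧ (edgeFree L (pendants 2 k 10) ∧ edgeFree L (pendants 3 (k + 2) (10 + 2 * k)))
        ≡⟨ cong₂ _∧_ (edgeFree-pendants L 1 3 4)
                     (cong₂ _∧_ (edgeFree-pendants L 2 k 10) (edgeFree-pendants L 3 (k + 2) (10 + 2 * k))) ⟩
      pendantsFree (replicate 3 b₁) bs
        ∧ (pendantsFree (replicate k b₂) (drop 6 bs) ∧ pendantsFree (replicate (k + 2) b₃) (drop (6 + 2 * k) bs))
        ≡⟨ cong (λ rest → pendantsFree (replicate 3 b₁) bs ∧ (pendantsFree (replicate k b₂) (drop 6 bs) ∧ rest)) offset ⟩
      pendantsFree (replicate 3 b₁) bs
        ∧ (pendantsFree (replicate k b₂) (drop 6 bs)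
           ∧ pendantsFree (replicate (k + 2) b₃) (drop (2 * length (replicate k b₂)) (drop 6 bs)))
        ≡⟨ cong (pendantsFree (replicate 3 b₁) bs ∧_) (sym (pendantsFree-++ (replicate k b₂) (replicate (k + 2) b₃) (drop 6 bs))) ⟩
      pendantsFree (replicate 3 b₁) bs ∧ pendantsFree (replicate k b₂ ++ replicate (k + 2) b₃) (drop 6 bs)
        ≡⟨ sym (pendantsFree-++ (replicate 3 b₁) (replicate k b₂ ++ replicate (k + 2) b₃) bs) ⟩
      pendantsFree (attach b₁ b₂ b₃) bs ∎
      where
      offset : pendantsFree (replicate (k + 2) b₃) (drop (6 + 2 * k) bs)
               ≡ pendantsFree (replicate (k + 2) b₃) (drop (2 * length (replicate k b₂)) (drop 6 bs))
      offset = sym (cong (pendantsFree (replicate (k + 2) b₃))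
                         (trans (cong (λ l → drop (2 * l) (drop 6 bs)) (length-replicate k)) (drop-drop 6 (2 * k) bs)))

  countStrings-attach : ∀ b₁ b₂ b₃ j →
    countStrings (λ bs → pendantsFree (attach b₁ b₂ b₃) bs ∧ (weight bs ≡ᵇ j)) (10 + 4 * k) ≡ pendantCount (attach b₁ b₂ b₃) j
  countStrings-attach b₁ b₂ b₃ j =
    trans (cong (countStrings (λ bs → pendantsFree (attach b₁ b₂ b₃) bs ∧ (weight bs ≡ᵇ j))) (sym bitCount))
          (countStrings-pendants (attach b₁ b₂ b₃) j)
    where
    double : ∀ k → 2 * (5 + 2 * k) ≡ 10 + 4 * k
    double = solve-∀
    bitCount : 2 * length (attach b₁ b₂ b₃) ≡ 10 + 4 * k
    bitCount = trans (cong (2 *_) (length-attach b₁ b₂ b₃)) (double k)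

  private
    Indep : ℕ → List Bool → Bool
    Indep j L = edgeFree L (edges (treeG k)) ∧ (weight L ≡ᵇ j)

    centreCount : ℕ → Bool → Bool → Bool → Bool → ℕ
    centreCount j b₀ b₁ b₂ b₃ = countStrings (λ bs → Indep j (b₀ ∷ b₁ ∷ b₂ ∷ b₃ ∷ bs)) (10 + 4 * k)

  indepCount-centre : ∀ j → indepCount (treeG k) j ≡ Σ𝔹 λ b₀ → Σ𝔹³ (centreCount j b₀)
  indepCount-centre j =
    trans (indepCount≡countStrings (treeG k) j)
          (trans (countStrings-pair (Indep j) (12 + 4 * k))
                 (Σ𝔹-cong λ b₀ → Σ𝔹-cong λ b₁ → countStrings-pair (λ bs → Indep j (b₀ ∷ b₁ ∷ bs)) (10 + 4 * k)))

  centreCount-v₀-in : ∀ x → Σ𝔹³ (centreCount (3 + x) true) ≡ pendantCount (attach false false false) (2 + x)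
  centreCount-v₀-in x =
    trans (Σ𝔹³-cong λ b₁ b₂ b₃ →
             countStrings-cong (λ bs → cong (_∧ (weight (true ∷ b₁ ∷ b₂ ∷ b₃ ∷ bs) ≡ᵇ 3 + x)) (edgeFree-treeG true b₁ b₂ b₃ bs))
                               (10 + 4 * k))
          (cong₂ _+_ (cong₂ _+_ (cong₂ _+_ none none) (cong₂ _+_ none none))
                     (cong₂ _+_ (cong₂ _+_ none none) (cong₂ _+_ none (countStrings-attach false false false (2 + x)))))
    where
    none : countStrings (λ _ → false) (10 + 4 * k) ≡ 0
    none = countStrings-false (10 + 4 * k)

  centreCount-v₀-out : ∀ x b₁ b₂ b₃ →
    centreCount (3 + x) false b₁ b₂ b₃ ≡ pendantCount (attach b₁ b₂ b₃) (absent b₁ b₂ b₃ + x)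
  centreCount-v₀-out x b₁ b₂ b₃ =
    trans (countStrings-cong (λ bs → cong₂ _∧_ (edgeFree-treeG false b₁ b₂ b₃ bs) (weight-centre b₁ b₂ b₃ x bs)) (10 + 4 * k))
          (countStrings-attach b₁ b₂ b₃ (absent b₁ b₂ b₃ + x))

  indepCount-by-deficit : ∀ d x → x + d ≡ 5 + 2 * k →
    indepCount (treeG k) (3 + x) ≡ topCountOffset d 2 (attach false false false)
                                   + Σ𝔹³ (λ b₁ b₂ b₃ → topCountOffset d (absent b₁ b₂ b₃) (attach b₁ b₂ b₃))
  indepCount-by-deficit d x x+d≡ =
    trans (indepCount-centre (3 + x))
          (cong₂ _+_ (trans (centreCount-v₀-in x) (offset false false false 2))
                     (Σ𝔹³-cong λ b₁ b₂ b₃ → trans (centreCount-v₀-out x b₁ b₂ b₃) (offset b₁ b₂ b₃ (absent b₁ b₂ b₃))))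
    where
    offset : ∀ b₁ b₂ b₃ e → pendantCount (attach b₁ b₂ b₃) (e + x) ≡ topCountOffset d e (attach b₁ b₂ b₃)
    offset b₁ b₂ b₃ e = pendantCount-offset (attach b₁ b₂ b₃) e x d (trans x+d≡ (sym (length-attach b₁ b₂ b₃)))

  topCount₀-attach : ∀ b₁ b₂ b₃ → topCount 0 (attach b₁ b₂ b₃) ≡ choices b₁ ^ 3 * (choices b₂ ^ k * choices b₃ ^ (k + 2))
  topCount₀-attach b₁ b₂ b₃ =
    trans (topCount₀-replicate-++ 3 b₁ (replicate k b₂ ++ replicate (k + 2) b₃))
          (cong (choices b₁ ^ 3 *_) (trans (topCount₀-replicate-++ k b₂ (replicate (k + 2) b₃))
                                           (cong (choices b₂ ^ k *_) (topCount₀-replicate (k + 2) b₃))))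

  topCount₁-attach-all-in : topCount 1 (attach true true true) ≡ 5 + 2 * k
  topCount₁-attach-all-in
    rewrite topCount₁-replicate-true-++ 3 (replicate k true ++ replicate (k + 2) true)
          | topCount₁-replicate-true-++ k (replicate (k + 2) true)
          | topCount₀-replicate-++ k true (replicate (k + 2) true)
          | topCount₀-replicate (k + 2) true | topCount₁-replicate-true (k + 2) | ^-zeroˡ k | ^-zeroˡ (k + 2) = rearrange k
    where
    rearrange : ∀ k → k + 2 + k * 1 + 3 * (1 * 1) ≡ 5 + 2 * k
    rearrange = solve-∀

  topCount₁-attach-in-in-out : 4 * (k + 3) * 2 ^ k ≤ topCount 1 (attach true true false)
  topCount₁-attach-in-in-out
    rewrite topCount₁-replicate-true-++ 3 (replicate k true ++ replicate (k + 2) false)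
          | topCount₁-replicate-true-++ k (replicate (k + 2) false)
          | topCount₀-replicate-++ k true (replicate (k + 2) false)
          | topCount₀-replicate (k + 2) false | ^-zeroˡ k | ^-distribˡ-+-* 2 k 2 =
    ≤-trans (≤-reflexive (rearrange k (2 ^ k)))
            (+-monoˡ-≤ (3 * (1 * (2 ^ k * 4))) (+-monoˡ-≤ (k * (2 ^ k * 4)) (z≤n {topCount 1 (replicate (k + 2) false)})))
    where
    rearrange : ∀ k p → 4 * (k + 3) * p ≡ 0 + k * (p * 4) + 3 * (1 * (p * 4))
    rearrange = solve-∀

  -- Composing with trans rather than rewriting keeps Agda from unfolding indepCount (treeG k),
  -- which would enumerate all 2^(14+4k) subsets.
  indepCount-treeG-8+2k : indepCount (treeG k) (8 + 2 * k) ≡ 1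
  indepCount-treeG-8+2k = trans (indepCount-by-deficit 0 (5 + 2 * k) (+-identityʳ (5 + 2 * k))) value
    where
    value : topCountOffset 0 2 (attach false false false)
            + Σ𝔹³ (λ b₁ b₂ b₃ → topCountOffset 0 (absent b₁ b₂ b₃) (attach b₁ b₂ b₃)) ≡ 1
    value rewrite topCount₀-attach true true true | ^-zeroˡ k | ^-zeroˡ (k + 2) = refl

  indepCount-treeG-7+2k : indepCount (treeG k) (7 + 2 * k) ≡ 5 * 2 ^ k + 2 * k + 13
  indepCount-treeG-7+2k = trans (indepCount-by-deficit 1 (4 + 2 * k) (+-comm (4 + 2 * k) 1)) value
    where
    value : topCountOffset 1 2 (attach false false false)
            + Σ𝔹³ (λ b₁ b₂ b₃ → topCountOffset 1 (absent b₁ b₂ b₃) (attach b₁ b₂ b₃)) ≡ 5 * 2 ^ k + 2 * k + 13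
    value rewrite topCount₁-attach-all-in | topCount₀-attach true true false | topCount₀-attach true false true
          | topCount₀-attach false true true | ^-zeroˡ k | ^-zeroˡ (k + 2) | ^-distribˡ-+-* 2 k 2 = rearrange k (2 ^ k)
      where
      rearrange : ∀ k p → 5 + 2 * k + 1 * (1 * (p * 4)) + (1 * (p * 1) + 0) + 8 ≡ 5 * p + 2 * k + 13
      rearrange = solve-∀

  indepCount-treeG-6+2k-≥ : 36 * (2 ^ k * 2 ^ k) + (52 + 4 * k) * 2 ^ k ≤ indepCount (treeG k) (6 + 2 * k)
  indepCount-treeG-6+2k-≥ =
    subst (36 * (2 ^ k * 2 ^ k) + (52 + 4 * k) * 2 ^ k ≤_) (sym (indepCount-by-deficit 2 (3 + 2 * k) (+-comm (3 + 2 * k) 2))) bound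
    where
    bound : 36 * (2 ^ k * 2 ^ k) + (52 + 4 * k) * 2 ^ k
            ≤ topCountOffset 2 2 (attach false false false)
              + Σ𝔹³ (λ b₁ b₂ b₃ → topCountOffset 2 (absent b₁ b₂ b₃) (attach b₁ b₂ b₃))
    bound rewrite topCount₀-attach false false false | topCount₀-attach true false false
                | topCount₀-attach false true false | topCount₀-attach false false true
                | ^-zeroˡ k | ^-zeroˡ (k + 2) | ^-distribˡ-+-* 2 k 2 =
      ≤-trans (≤-reflexive (rearrange k (2 ^ k)))
              (+-monoʳ-≤ (8 * (p * (p * 4)))
                 (+-mono-≤ (+-mono-≤ (+-mono-≤ (z≤n {topCount 2 (attach true true true)}) topCount₁-attach-in-in-out)
                                     (+-monoˡ-≤ (1 * (p * (p * 4))) (z≤n {topCount 1 (attach true false true)})))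
                           (+-mono-≤ (+-monoˡ-≤ (8 * (1 * (p * 4))) (z≤n {topCount 1 (attach false true true)})) ≤-refl)))
      where
      p : ℕ
      p = 2 ^ k
      rearrange : ∀ k p → 36 * (p * p) + (52 + 4 * k) * p
        ≡ 8 * (p * (p * 4)) + ((0 + 4 * (k + 3) * p) + (0 + 1 * (p * (p * 4))) + ((0 + 8 * (1 * (p * 4))) + (8 * (p * 1) + 0)))
      rearrange = solve-∀

≤-foldr-⊔ : {A : Set} (f : A → ℕ) {x : A} {xs : List A} → x ∈ xs → f x ≤ foldr _⊔_ 0 (map f xs)
≤-foldr-⊔ f (here refl) = m≤m⊔n _ _
≤-foldr-⊔ f {xs = y ∷ xs} (there x∈xs) = ≤-trans (≤-foldr-⊔ f x∈xs) (m≤n⊔m (f y) _)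

indepCount-pos⇒≤α : ∀ G j → 0 < indepCount G j → j ≤ α G
indepCount-pos⇒≤α G j pos with countᵇ-witness _ (independentSets G) pos
... | S , S∈ , ∣S∣≡j = subst (_≤ α G) (≡ᵇ⇒≡ ∣ S ∣ j ∣S∣≡j) (≤-foldr-⊔ ∣_∣ S∈)

coeff-map-applyUpTo : ∀ (f g : ℕ → ℕ) n i → i < n → coeff (map f (applyUpTo g n)) i ≡ f (g i)
coeff-map-applyUpTo f g (suc n) zero _ = refl
coeff-map-applyUpTo f g (suc n) (suc i) (s≤s i<n) = coeff-map-applyUpTo f (g ∘ suc) n i i<n

coeff-indepPoly : ∀ G i → i ≤ α G → coeff (indepPoly G) i ≡ indepCount G i
coeff-indepPoly G i i≤α = coeff-map-applyUpTo (indepCount G) (λ x → x) (suc (α G)) i (s≤s i≤α)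

logConcave⇒indepCount : ∀ G j → LogConcave (indepPoly G) → 2 + j ≤ α G →
  indepCount G j * indepCount G (2 + j) ≤ indepCount G (1 + j) * indepCount G (1 + j)
logConcave⇒indepCount G j logConcave 2+j≤α =
  subst₂ _≤_ (cong₂ _*_ (coeff-indepPoly G j (≤-trans (m≤n+m j 2) 2+j≤α)) (coeff-indepPoly G (2 + j) 2+j≤α))
             (cong₂ _*_ next next)
             (logConcave j (inRange (≤-trans (n≤1+n (1 + j)) 2+j≤α)) (inRange 2+j≤α))
  where
  inRange : ∀ {i} → i ≤ α G → i < length (indepPoly G)
  inRange {i} i≤α = subst (i <_) (sym (trans (length-map (indepCount G) (upTo (suc (α G)))) (length-upTo (suc (α G))))) (s≤s i≤α)
  next : coeff (indepPoly G) (1 + j) ≡ indepCount G (1 + j)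
  next = coeff-indepPoly G (1 + j) (≤-trans (n≤1+n (1 + j)) 2+j≤α)

2k+13≤2^k : ∀ n → 2 * (5 + n) + 13 ≤ 2 ^ (5 + n)
2k+13≤2^k zero = ≤ᵇ⇒≤ 23 32 _
2k+13≤2^k (suc n) = begin
  2 * (6 + n) + 13        ≡⟨ rearrange n ⟩
  (2 * (5 + n) + 13) + 2  ≤⟨ +-mono-≤ (2k+13≤2^k n) (≤-trans (s≤s (s≤s z≤n)) (2k+13≤2^k n)) ⟩
  2 ^ (5 + n) + 2 ^ (5 + n) ≡⟨ cong (2 ^ (5 + n) +_) (sym (+-identityʳ _)) ⟩
  2 ^ (6 + n)             ∎
  where
  open ≤-Reasoning
  rearrange : ∀ n → 2 * (6 + n) + 13 ≡ (2 * (5 + n) + 13) + 2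
  rearrange = solve-∀

square<low : ∀ k p → 2 * k + 13 ≤ p → (5 * p + 2 * k + 13) * (5 * p + 2 * k + 13) < 36 * (p * p) + (52 + 4 * k) * p
square<low k p 2k+13≤p = begin-strict
  (5 * p + 2 * k + 13) * (5 * p + 2 * k + 13) ≤⟨ *-mono-≤ ≤6p ≤6p ⟩
  (6 * p) * (6 * p)                            ≡⟨ six p ⟩
  36 * (p * p) + 0                             <⟨ +-monoʳ-< (36 * (p * p)) positive ⟩
  36 * (p * p) + (52 + 4 * k) * p              ∎
  where
  open ≤-Reasoning
  six : ∀ p → (6 * p) * (6 * p) ≡ 36 * (p * p) + 0
  six = solve-∀
  split : ∀ k p → 5 * p + 2 * k + 13 ≡ 5 * p + (2 * k + 13)
  split = solve-∀
  ≤6p : 5 * p + 2 * k + 13 ≤ 6 * p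
  ≤6p = ≤-trans (≤-reflexive (split k p)) (≤-trans (+-monoʳ-≤ (5 * p) 2k+13≤p) (≤-reflexive (five+one p)))
    where
    five+one : ∀ p → 5 * p + p ≡ 6 * p
    five+one = solve-∀
  positive : 0 < (52 + 4 * k) * p
  positive = ≤-trans (≤-trans (s≤s z≤n) (≤-trans (m≤n+m 13 (2 * k)) 2k+13≤p)) (m≤n*m p (52 + 4 * k))

coefficient-gap : ∀ k → 4 ≤ k → (5 * 2 ^ k + 2 * k + 13) * (5 * 2 ^ k + 2 * k + 13) < 36 * (2 ^ k * 2 ^ k) + (52 + 4 * k) * 2 ^ k
coefficient-gap 0 ()
coefficient-gap 1 (s≤s ())
coefficient-gap 2 (s≤s (s≤s ()))
coefficient-gap 3 (s≤s (s≤s (s≤s ())))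
coefficient-gap 4 _ = ≤ᵇ⇒≤ _ _ _
coefficient-gap (suc (suc (suc (suc (suc n))))) _ = square<low (5 + n) (2 ^ (5 + n)) (2k+13≤2^k n)

mainTheorem2 : (k : ℕ) → 4 ≤ k → ¬ LogConcave (indepPoly (treeG k))
mainTheorem2 k 4≤k logConcave = <⇒≱ (coefficient-gap k 4≤k) (begin
  36 * (2 ^ k * 2 ^ k) + (52 + 4 * k) * 2 ^ k ≤⟨ indepCount-treeG-6+2k-≥ k ⟩
  s (6 + 2 * k)                               ≡⟨ sym (*-identityʳ _) ⟩
  s (6 + 2 * k) * 1                           ≡⟨ cong (s (6 + 2 * k) *_) (sym top) ⟩
  s (6 + 2 * k) * s (8 + 2 * k)               ≤⟨ logConcave⇒indepCount (treeG k) (6 + 2 * k) logConcave α-bound ⟩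
  s (7 + 2 * k) * s (7 + 2 * k)               ≡⟨ cong₂ _*_ (indepCount-treeG-7+2k k) (indepCount-treeG-7+2k k) ⟩
  (5 * 2 ^ k + 2 * k + 13) * (5 * 2 ^ k + 2 * k + 13) ∎)
  where
  open ≤-Reasoning
  s : ℕ → ℕ
  s = indepCount (treeG k)
  top : s (8 + 2 * k) ≡ 1
  top = indepCount-treeG-8+2k k
  α-bound : 8 + 2 * k ≤ α (treeG k)
  α-bound = indepCount-pos⇒≤α (treeG k) (8 + 2 * k) (≤-reflexive (sym top))
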